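{- Let $n\ge 2\ell\ge 2$ be integers and let $\Gamma$ be the set of permutations defined below. Each permutation in $\Gamma$ can be partitioned into $\ell$ decreasing subsequences in exactly one way, and for two different permutations in $\Gamma$ these unique partitions (viewed as partitions of the position set $\{1,\dots,n\}$) are different.
   Context: $\Gamma$ is defined as follows. Consider positions $1,\dots,n$. A partition $P_1,\dots,P_\ell$ of the positions is admissible if, for each $1\le i\le\ell$, position $i$ and position $n-\ell+i$ belong to $P_i$, and each of the remaining positions $\ell+1,\dots,n-2\ell+\ell=n-\ell$ (i.e., positions $\ell+1,\dots,n-\ell$) is assigned to an arbitrary part; there are $\ell^{n-2\ell}$ admissible partitions. For each admissible partition, the corresponding permutation $(x_1,\dots,x_n)$ of $\{1,\dots,n\}$ is the unique one such that the values at the positions of each $P_i$ form a decreasing sequence (in order of positions) and every value at a position of $P_i$ is smaller than every value at a position of $P_{i+1}$, for $1\le i\le\ell-1$. $\Gamma$ is the set of all these permutations. A partition into decreasing subsequences is a partition of the set of positions into classes such that the values at each class, read in increasing order of positions, are decreasing. -}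

module Defs where

open import Data.Nat using (ℕ; _∸_; _+_)
open import Data.Fin using (Fin; toℕ; _<_)
open import Data.Fin.Permutation using (Permutation′; _⟨$⟩ʳ_)
open import Data.Product using (Σ; ∃; _×_)
open import Relation.Binary.PropositionalEquality using (_≡_)
open import Function.Bundles using (_⇔_)

-- A labelling of the positions Fin n (0-indexed: position p here is
-- position p+1 of the paper) by part indices Fin ℓ.
Labelling : ℕ → ℕ → Set
Labelling n ℓ = Fin n → Fin ℓ

Admissible : (n ℓ : ℕ) → Labelling n ℓ → Set
Admissible n ℓ f =
  (p : Fin n) (i : Fin ℓ) →
    (toℕ p ≡ toℕ i → f p ≡ i) × (toℕ p ≡ n ∸ ℓ + toℕ i → f p ≡ i)

Corresponds : {n ℓ : ℕ} → Labelling n ℓ → Permutation′ n → Set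
Corresponds {n} f σ =
  (p q : Fin n) →
    (f p < f q → σ ⟨$⟩ʳ p < σ ⟨$⟩ʳ q) ×
    (f p ≡ f q → p < q → σ ⟨$⟩ʳ q < σ ⟨$⟩ʳ p)

InΓ : (n ℓ : ℕ) → Permutation′ n → Set
InΓ n ℓ σ = Σ (Labelling n ℓ) λ f → Admissible n ℓ f × Corresponds f σ

-- A partition of the positions of σ into ℓ decreasing subsequences,
-- given as a labelling onto Fin ℓ (every class nonempty) such that each
-- class is decreasing.
DecPartition : {n : ℕ} (ℓ : ℕ) → Permutation′ n → Labelling n ℓ → Set
DecPartition {n} ℓ σ g =
  ((i : Fin ℓ) → ∃ λ p → g p ≡ i) ×
  ((p q : Fin n) → g p ≡ g q → p < q → σ ⟨$⟩ʳ q < σ ⟨$⟩ʳ p)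

SamePartition : {n ℓ : ℕ} → Labelling n ℓ → Labelling n ℓ → Set
SamePartition {n} g h = (p q : Fin n) → (g p ≡ g q) ⇔ (h p ≡ h q)

-- For an admissible labelling f, positions i and n-ℓ+i carry label i. Let g be any partition
-- of σ into ℓ decreasing subsequences. Inside one g-class the values decrease, while f orders
-- the values by label, so a smaller f-label forces a later position. Hence the first ℓ positions
-- lie in ℓ distinct g-classes, i.e. in all of them; downward induction on i puts position n-ℓ+i
-- in the class of position i, and then every position p lies in the class of position f(p).
-- So g and f induce the same partition. Conversely the partition determines f (position i has
-- label i), and f determines the relative order of the values of σ, hence σ itself.
module Submission where

open import Defs
open import Data.Nat using (ℕ; _≤_; _*_)
open import Data.Fin.Permutation using (Permutation′; _⟨$⟩ʳ_)
open import Data.Product using (Σ; ∃; _×_)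
open import Relation.Binary.PropositionalEquality using (_≡_)
open import Relation.Nullary using (¬_)

open import Data.Nat as ℕ using (_+_; _∸_; z≤n)
import Data.Nat.Properties as ℕ
open import Data.Fin using (Fin; zero; suc; toℕ; fromℕ<; inject≤; inject₁; _<_)
open import Data.Fin.Properties
  using ( toℕ-injective; toℕ<n; toℕ-fromℕ<; toℕ-inject≤; toℕ-inject₁
        ; <-cmp; <-asym; <-irrefl; pigeonhole)
open import Data.Fin.Induction using (>-wellFounded)
open import Data.Fin.Permutation using (_⟨$⟩ˡ_; inverseˡ; inverseʳ)
open import Data.Vec.Functional using (_∷_)
open import Data.Product using (_,_; proj₁; proj₂)
open import Data.Empty using (⊥-elim)
open import Function.Base using (_∘_)
open import Function.Bundles using (_⇔_; mk⇔; Equivalence)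
open import Function.Construct.Composition using (_⇔-∘_)
open import Function.Construct.Symmetry using (⇔-sym)
open import Function.Definitions using (Injective)
open import Induction.WellFounded using (module All)
open import Relation.Binary.Definitions using (tri<; tri≈; tri>)
open import Relation.Binary.PropositionalEquality
  using (_≗_; refl; sym; trans; cong; subst; subst₂; module ≡-Reasoning)

strictMono⇒toℕ≤ : ∀ {m k} (ψ : Fin m → Fin k) → (∀ {x y} → x < y → ψ x < ψ y) →
                  ∀ x → toℕ x ≤ toℕ (ψ x)
strictMono⇒toℕ≤ ψ mono zero    = z≤n
strictMono⇒toℕ≤ ψ mono (suc x) = ℕ.≤-<-trans x≤ψx (mono x<suc-x)
  where
  inject₁-mono : ∀ {x y} → x < y → inject₁ x < inject₁ y
  inject₁-mono {x} {y} = subst₂ ℕ._<_ (sym (toℕ-inject₁ x)) (sym (toℕ-inject₁ y))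

  x≤ψx : toℕ x ≤ toℕ (ψ (inject₁ x))
  x≤ψx = strictMono⇒toℕ≤ (ψ ∘ inject₁) (mono ∘ inject₁-mono) x

  x<suc-x : inject₁ x < suc x
  x<suc-x = ℕ.s≤s (ℕ.≤-reflexive (toℕ-inject₁ x))

injective⇒surjective : ∀ {m} {φ : Fin m → Fin m} → Injective _≡_ _≡_ φ →
                       ∀ y → ∃ λ x → φ x ≡ y
injective⇒surjective {m} {φ} inj y with pigeonhole (ℕ.n<1+n m) (y ∷ φ)
... | zero  , suc x , _  , y≡φx = x , sym y≡φx
... | suc x , suc z , x<z , φx≡φz = ⊥-elim (<-irrefl (cong suc (inj φx≡φz)) x<z)

module _ {n} {σ τ : Permutation′ n} where

  orderPreserving⇒≤ : (∀ p q → σ ⟨$⟩ʳ p < σ ⟨$⟩ʳ q → τ ⟨$⟩ʳ p < τ ⟨$⟩ʳ q) →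
                      ∀ p → toℕ (σ ⟨$⟩ʳ p) ≤ toℕ (τ ⟨$⟩ʳ p)
  orderPreserving⇒≤ preserves p =
    subst (λ r → toℕ (σ ⟨$⟩ʳ p) ≤ toℕ (τ ⟨$⟩ʳ r)) (inverseˡ σ)
      (strictMono⇒toℕ≤ (λ x → τ ⟨$⟩ʳ (σ ⟨$⟩ˡ x)) τσ⁻¹-mono (σ ⟨$⟩ʳ p))
    where
    τσ⁻¹-mono : ∀ {x y} → x < y → τ ⟨$⟩ʳ (σ ⟨$⟩ˡ x) < τ ⟨$⟩ʳ (σ ⟨$⟩ˡ y)
    τσ⁻¹-mono x<y = preserves _ _ (subst₂ _<_ (sym (inverseʳ σ)) (sym (inverseʳ σ)) x<y)

  module _ {ℓ} {f f′ : Labelling n ℓ} (f≗f′ : f ≗ f′)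
           (corσ : Corresponds f σ) (corτ : Corresponds f′ τ) where

    corresponds-order : ∀ p q → σ ⟨$⟩ʳ p < σ ⟨$⟩ʳ q → τ ⟨$⟩ʳ p < τ ⟨$⟩ʳ q
    corresponds-order p q σp<σq with <-cmp (f p) (f q) | <-cmp p q
    ... | tri< fp<fq _ _ | _ = proj₁ (corτ p q) (subst₂ _<_ (f≗f′ p) (f≗f′ q) fp<fq)
    ... | tri> _ _ fq<fp | _ = ⊥-elim (<-asym σp<σq (proj₁ (corσ q p) fq<fp))
    ... | tri≈ _ fp≡fq _ | tri< p<q _ _ = ⊥-elim (<-asym σp<σq (proj₂ (corσ p q) fp≡fq p<q))
    ... | tri≈ _ _ _     | tri≈ _ refl _ = ⊥-elim (<-irrefl refl σp<σq)
    ... | tri≈ _ fp≡fq _ | tri> _ _ q<p =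
      proj₂ (corτ q p) (trans (sym (f≗f′ q)) (trans (sym fp≡fq) (f≗f′ p))) q<p

corresponds-unique : ∀ {n ℓ} {σ τ : Permutation′ n} {f f′ : Labelling n ℓ} → f ≗ f′ →
                     Corresponds f σ → Corresponds f′ τ → ∀ p → σ ⟨$⟩ʳ p ≡ τ ⟨$⟩ʳ p
corresponds-unique {σ = σ} {τ} f≗f′ corσ corτ p = toℕ-injective (ℕ.≤-antisym
  (orderPreserving⇒≤ {σ = σ} {τ} (corresponds-order {σ = σ} {τ} f≗f′ corσ corτ) p)
  (orderPreserving⇒≤ {σ = τ} {σ} (corresponds-order {σ = τ} {σ} (sym ∘ f≗f′) corτ corσ) p))

Decreasing : ∀ {n ℓ} → Permutation′ n → Labelling n ℓ → Set
Decreasing σ g = ∀ p q → g p ≡ g q → p < q → σ ⟨$⟩ʳ q < σ ⟨$⟩ʳ p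

classmates-reverse-labels : ∀ {n ℓ} {σ : Permutation′ n} {f g : Labelling n ℓ} →
                            Corresponds f σ → Decreasing σ g →
                            ∀ {p q} → g p ≡ g q → f p < f q → q < p
classmates-reverse-labels cor dec {p} {q} gp≡gq fp<fq with <-cmp p q
... | tri< p<q _ _ = ⊥-elim (<-asym (proj₁ (cor p q) fp<fq) (dec p q gp≡gq p<q))
... | tri≈ _ refl _ = ⊥-elim (<-irrefl refl fp<fq)
... | tri> _ _ q<p = q<p

module Positions {n ℓ} (2ℓ≤n : 2 * ℓ ≤ n) where

  ℓ+ℓ≤n : ℓ + ℓ ≤ n
  ℓ+ℓ≤n = subst (λ k → ℓ + k ≤ n) (ℕ.+-identityʳ ℓ) 2ℓ≤n

  ℓ≤n : ℓ ≤ n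
  ℓ≤n = ℕ.m+n≤o⇒n≤o ℓ ℓ+ℓ≤n

  ℓ≤n∸ℓ : ℓ ≤ n ∸ ℓ
  ℓ≤n∸ℓ = ℕ.m+n≤o⇒m≤o∸n ℓ ℓ+ℓ≤n

  n∸ℓ+ℓ≡n : n ∸ ℓ + ℓ ≡ n
  n∸ℓ+ℓ≡n = ℕ.m∸n+n≡m ℓ≤n

  front : Fin ℓ → Fin n
  front i = inject≤ i ℓ≤n

  back : Fin ℓ → Fin n
  back i = fromℕ< (subst (n ∸ ℓ + toℕ i ℕ.<_) n∸ℓ+ℓ≡n (ℕ.+-monoʳ-< (n ∸ ℓ) (toℕ<n i)))

  toℕ-front : ∀ i → toℕ (front i) ≡ toℕ i
  toℕ-front i = toℕ-inject≤ i ℓ≤n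

  toℕ-back : ∀ i → toℕ (back i) ≡ n ∸ ℓ + toℕ i
  toℕ-back i = toℕ-fromℕ< _

  front<back : ∀ i j → front i < back j
  front<back i j = subst₂ ℕ._<_ (sym (toℕ-front i)) (sym (toℕ-back j))
    (ℕ.<-≤-trans (toℕ<n i) (ℕ.≤-trans ℓ≤n∸ℓ (ℕ.m≤m+n (n ∸ ℓ) (toℕ j))))

  front-cancel-< : ∀ {i j} → front i < front j → i < j
  front-cancel-< {i} {j} = subst₂ ℕ._<_ (toℕ-front i) (toℕ-front j)

  back-cancel-< : ∀ {i j} → back i < back j → i < j
  back-cancel-< {i} {j} = ℕ.+-cancelˡ-< (n ∸ ℓ) _ _ ∘ subst₂ ℕ._<_ (toℕ-back i) (toℕ-back j)

  before-front : ∀ {p i} → p < front i → ∃ λ k → p ≡ front k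
  before-front {p} {i} p<i = fromℕ< p<ℓ , toℕ-injective (sym (trans (toℕ-front _) (toℕ-fromℕ< p<ℓ)))
    where
    p<ℓ : toℕ p ℕ.< ℓ
    p<ℓ = ℕ.<-trans (subst (toℕ p ℕ.<_) (toℕ-front i) p<i) (toℕ<n i)

  after-back : ∀ {i p} → back i < p → ∃ λ k → p ≡ back k
  after-back {i} {p} i<p = fromℕ< k<ℓ , toℕ-injective (sym (begin
      toℕ (back (fromℕ< k<ℓ))            ≡⟨ toℕ-back _ ⟩
      n ∸ ℓ + toℕ (fromℕ< k<ℓ)            ≡⟨ cong (n ∸ ℓ +_) (toℕ-fromℕ< k<ℓ) ⟩
      n ∸ ℓ + (toℕ p ∸ (n ∸ ℓ))           ≡⟨ ℕ.m+[n∸m]≡n n∸ℓ≤p ⟩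
      toℕ p                               ∎))
    where
    open ≡-Reasoning
    n∸ℓ≤p : n ∸ ℓ ≤ toℕ p
    n∸ℓ≤p = ℕ.m+n≤o⇒m≤o (n ∸ ℓ) (ℕ.<⇒≤ (subst (ℕ._< toℕ p) (toℕ-back i) i<p))

    k<ℓ : toℕ p ∸ (n ∸ ℓ) ℕ.< ℓ
    k<ℓ = ℕ.+-cancelˡ-< (n ∸ ℓ) _ _
      (subst₂ ℕ._<_ (sym (ℕ.m+[n∸m]≡n n∸ℓ≤p)) (sym n∸ℓ+ℓ≡n) (toℕ<n p))

  module _ (f : Labelling n ℓ) (adm : Admissible n ℓ f) where

    label-front : ∀ i → f (front i) ≡ i
    label-front i = proj₁ (adm (front i) i) (toℕ-front i)

    label-back : ∀ i → f (back i) ≡ i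
    label-back i = proj₂ (adm (back i) i) (toℕ-back i)

    before-front⇒label< : ∀ {p i} → p < front i → f p < i
    before-front⇒label< p<i with before-front p<i
    ... | k , refl = subst (_< _) (sym (label-front k)) (front-cancel-< p<i)

    after-back⇒label> : ∀ {i p} → back i < p → i < f p
    after-back⇒label> i<p with after-back i<p
    ... | k , refl = subst (_ <_) (sym (label-back k)) (back-cancel-< i<p)

    corresponds⇒decPartition : ∀ σ → Corresponds f σ → DecPartition ℓ σ f
    corresponds⇒decPartition σ cor = (λ i → front i , label-front i) , (λ p q → proj₂ (cor p q))

    module _ (σ : Permutation′ n) (cor : Corresponds f σ)
             (g : Labelling n ℓ) (dec : Decreasing σ g) where

      classmates-reverse : ∀ {p q} → g p ≡ g q → f p < f q → q < p
      classmates-reverse = classmates-reverse-labels {σ = σ} {f} {g} cor dec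

      front-class-order : ∀ {i j} → g (front i) ≡ g (front j) → ¬ i < j
      front-class-order {i} {j} gi≡gj i<j = <-asym i<j
        (subst (_< i) (label-front j) (before-front⇒label< (classmates-reverse gi≡gj
          (subst₂ _<_ (sym (label-front i)) (sym (label-front j)) i<j))))

      front-classes-injective : Injective _≡_ _≡_ (g ∘ front)
      front-classes-injective {i} {j} gi≡gj with <-cmp i j
      ... | tri< i<j _ _ = ⊥-elim (front-class-order gi≡gj i<j)
      ... | tri≈ _ i≡j _ = i≡j
      ... | tri> _ _ j<i = ⊥-elim (front-class-order (sym gi≡gj) j<i)

      classmate-front : ∀ p → ∃ λ m → g (front m) ≡ g p
      classmate-front p = injective⇒surjective front-classes-injective (g p)

      back-classmate-front : ∀ k → g (back k) ≡ g (front k)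
      back-classmate-front = All.wfRec >-wellFounded _ (λ k → g (back k) ≡ g (front k)) step
        where
        step : ∀ k → (∀ {m} → k < m → g (back m) ≡ g (front m)) → g (back k) ≡ g (front k)
        step k IH with classmate-front (back k)
        ... | m , gm≡gk with <-cmp m k
        ... | tri< m<k _ _ = ⊥-elim (<-asym (front<back m k)
              (classmates-reverse gm≡gk
                (subst₂ _<_ (sym (label-front m)) (sym (label-back k)) m<k)))
        ... | tri≈ _ refl _ = sym gm≡gk
        ... | tri> _ _ k<m = ⊥-elim (<-asym k<m (subst (m <_) (label-back k)
              (after-back⇒label> (classmates-reverse (sym (trans (IH k<m) gm≡gk))
                (subst₂ _<_ (sym (label-back k)) (sym (label-back m)) k<m)))))

      class-of-label : ∀ p → g p ≡ g (front (f p))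
      class-of-label p with classmate-front p
      ... | m , gm≡gp with <-cmp m (f p)
      ... | tri< m<fp _ _ = ⊥-elim (<-asym m<fp
            (before-front⇒label< (classmates-reverse gm≡gp
              (subst (_< f p) (sym (label-front m)) m<fp))))
      ... | tri≈ _ refl _ = sym gm≡gp
      ... | tri> _ _ fp<m = ⊥-elim (<-asym fp<m
            (after-back⇒label> (classmates-reverse (sym (trans (back-classmate-front m) gm≡gp))
              (subst (f p <_) (sym (label-back m)) fp<m))))

      classes-agree : ∀ p q → (g p ≡ g q) ⇔ (f p ≡ f q)
      classes-agree p q = mk⇔
        (λ gp≡gq → front-classes-injective
          (trans (sym (class-of-label p)) (trans gp≡gq (class-of-label q))))
        (λ fp≡fq → trans (class-of-label p)
          (trans (cong (g ∘ front) fp≡fq) (sym (class-of-label q))))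

  labels-determined-by-classes : ∀ {f f′ : Labelling n ℓ} → Admissible n ℓ f → Admissible n ℓ f′ →
                                 (∀ p q → f p ≡ f q → f′ p ≡ f′ q) → f ≗ f′
  labels-determined-by-classes {f} {f′} adm adm′ same p =
    sym (trans (same p (front (f p)) (sym (label-front f adm (f p)))) (label-front f′ adm′ (f p)))

  Γ-decPartition-unique : ∀ σ → InΓ n ℓ σ →
    (∃ λ g → DecPartition ℓ σ g) ×
    (∀ g h → DecPartition ℓ σ g → DecPartition ℓ σ h → SamePartition g h)
  Γ-decPartition-unique σ (f , adm , cor) =
    (f , corresponds⇒decPartition f adm σ cor) ,
    λ g h dg dh p q → ⇔-sym (classes-agree f adm σ cor h (proj₂ dh) p q)
                      ⇔-∘ classes-agree f adm σ cor g (proj₂ dg) p q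

  Γ-samePartition⇒≡ : ∀ σ τ → InΓ n ℓ σ → InΓ n ℓ τ → ∀ g h →
    DecPartition ℓ σ g → DecPartition ℓ τ h → SamePartition g h → ∀ i → σ ⟨$⟩ʳ i ≡ τ ⟨$⟩ʳ i
  Γ-samePartition⇒≡ σ τ (f , adm , cor) (f′ , adm′ , cor′) g h dg dh g~h =
    corresponds-unique {σ = σ} {τ} (labels-determined-by-classes adm adm′ f~f′) cor cor′
    where
    f~f′ : ∀ p q → f p ≡ f q → f′ p ≡ f′ q
    f~f′ p q = Equivalence.to (classes-agree f′ adm′ τ cor′ h (proj₂ dh) p q)
             ∘ Equivalence.to (g~h p q)
             ∘ Equivalence.from (classes-agree f adm σ cor g (proj₂ dg) p q)

proposition23 : (n ℓ : ℕ) → 1 ≤ ℓ → 2 * ℓ ≤ n →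
    ((σ : Permutation′ n) → InΓ n ℓ σ →
    (∃ λ g → DecPartition ℓ σ g) ×
    ((g h : Labelling n ℓ) → DecPartition ℓ σ g → DecPartition ℓ σ h →
    SamePartition g h)) ×
    ((σ τ : Permutation′ n) → InΓ n ℓ σ → InΓ n ℓ τ →
    ¬ ((i : _) → σ ⟨$⟩ʳ i ≡ τ ⟨$⟩ʳ i) →
    (g h : Labelling n ℓ) → DecPartition ℓ σ g → DecPartition ℓ τ h →
    ¬ SamePartition g h)
proposition23 n ℓ _ 2ℓ≤n =
  Γ-decPartition-unique ,
  λ σ τ σ∈Γ τ∈Γ σ≢τ g h dg dh g~h → σ≢τ (Γ-samePartition⇒≡ σ τ σ∈Γ τ∈Γ g h dg dh g~h)
  where open Positions {ℓ = ℓ} 2ℓ≤n
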